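{- Let $i,j,k,\ell$ be vertices of a quadrilateral in counterclockwise order, triangulated by the diagonal $ik$ oriented $i\to k$ into the triangles $ijk$ and $ik\ell$, and let $\lambda_{j\ell}$ and the $\mu$-invariants $\boxed{ij\ell}$, $\boxed{jk\ell}$ be those obtained by flipping $ik$. Then (a) $h^i_{j\ell}=h^i_{jk}+h^i_{k\ell}+\overline\theta^{\,i}_{jk}\,\overline\theta^{\,i}_{k\ell}$; (b) $h^k_{j\ell}=h^k_{ji}+h^k_{i\ell}+\overline\theta^{\,k}_{ji}\,\overline\theta^{\,k}_{i\ell}$.
   Context: One works in a supercommutative algebra with even $\lambda$-lengths $\lambda_{xy}=\lambda_{yx}$ (having square roots) and odd $\mu$-invariants $\boxed{xyz}$ (symmetric in the labels). Flip rule: with $i,j,k,\ell$ counterclockwise, diagonal $ik$ oriented $i\to k$, $a=\lambda_{i\ell},b=\lambda_{\ell k},c=\lambda_{kj},d=\lambda_{ji},e=\lambda_{ik}$, $\theta=\boxed{ik\ell}$, $\sigma=\boxed{ijk}$, the new diagonal $j\ell$ has $f=\lambda_{j\ell}$ with $ef=ac+bd+\sqrt{abcd}\,\sigma\theta$, and the new $\mu$-invariants are $\sigma'=\boxed{jk\ell}=(\sigma\sqrt{bd}-\theta\sqrt{ac})/\sqrt{ef}$ and $\theta'=\boxed{ij\ell}=(\theta\sqrt{bd}+\sigma\sqrt{ac})/\sqrt{ef}$. For a triangle $xyz$: the $h$-length $h^x_{yz}=\lambda_{yz}/(\lambda_{xy}\lambda_{xz})$ and $\overline\theta^{\,x}_{yz}=\sqrt{h^x_{yz}}\,\boxed{xyz}$.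 -}

module Defs where

open import Level using (Level; _⊔_; suc)
open import Algebra.Bundles using (CommutativeRing)
open import Relation.Binary.PropositionalEquality using (_≡_)

-- A supercommutative algebra, presented by its even part (a commutative
-- ring) and its odd part, together with exactly the structure that is used:
--  * scalar multiplication of odd elements by even ones (_⊙_),
--  * the product of two odd elements, which is even (_·_), bilinear over
--    the even part and anticommuting,
--  * a predicate Pos of "positive" even elements (where lambda-lengths live),
--    closed under products and inverses, carrying inverses, and
--  * the square root of a positive element: THE positive element whose
--    square is it (existence + uniqueness).
record SuperAlgebra (c ℓ o : Level) : Set (suc (c ⊔ ℓ ⊔ o)) where
  field
    Even : CommutativeRing c ℓ
  open CommutativeRing Even public
  field
    Odd   : Set o
    _⊙_   : Carrier → Odd → Odd
    _·_   : Odd → Odd → Carrier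
    ⊙-assoc  : ∀ x y θ → (x * y) ⊙ θ ≡ x ⊙ (y ⊙ θ)
    ⊙-one    : ∀ θ → 1# ⊙ θ ≡ θ
    ⊙-congˡ  : ∀ {x y} θ → x ≈ y → x ⊙ θ ≡ y ⊙ θ
    ·-anticomm : ∀ θ σ → θ · σ ≈ - (σ · θ)
    ·-scaleˡ : ∀ x θ σ → (x ⊙ θ) · σ ≈ x * (θ · σ)
    ·-scaleʳ : ∀ x θ σ → θ · (x ⊙ σ) ≈ x * (θ · σ)
    Pos      : Carrier → Set ℓ
    Pos-resp : ∀ {x y} → x ≈ y → Pos x → Pos y
    Pos-*    : ∀ {x y} → Pos x → Pos y → Pos (x * y)
    inv      : Carrier → Carrier
    inv-cong : ∀ {x y} → x ≈ y → inv x ≈ inv y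
    inv-Pos  : ∀ {x} → Pos x → Pos (inv x)
    inverseʳ : ∀ {x} → Pos x → x * inv x ≈ 1#
    sqrt     : Carrier → Carrier
    sqrt-cong : ∀ {x y} → x ≈ y → sqrt x ≈ sqrt y
    sqrt-Pos : ∀ {x} → Pos x → Pos (sqrt x)
    sqrt-sq  : ∀ {x} → Pos x → sqrt x * sqrt x ≈ x
    sqrt-unique : ∀ {x y} → Pos x → Pos y → y * y ≈ x → y ≈ sqrt x

module _ {c ℓ o} (A : SuperAlgebra c ℓ o) where
  open SuperAlgebra A

  hlen : (λyz λxy λxz : Carrier) → Carrier
  hlen λyz λxy λxz = λyz * inv (λxy * λxz)

  θbar : (λyz λxy λxz : Carrier) → (μxyz : Odd) → Odd
  θbar λyz λxy λxz μ = sqrt (hlen λyz λxy λxz) ⊙ μ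

-- Both identities are the flip relation e f = a c + b d + sqrt(abcd) σθ divided by the product
-- λ_{xy} λ_{xk} λ_{xz} of the three λ-lengths at the vertex x = i or k: that product clears the
-- denominator of every h-length at x, and sqrt(h₁) sqrt(h₂) times it equals sqrt(abcd) by
-- uniqueness of positive square roots.
module Submission where

open import Defs
open import Data.Product using (_×_; _,_)
import Algebra.Solver.Ring.NaturalCoefficients.Default as RingSolver
import Relation.Binary.Reasoning.Setoid as SetoidReasoning

module SuperAlgebraProperties {c ℓ o} (A : SuperAlgebra c ℓ o) where
  open SuperAlgebra A
  open RingSolver commutativeSemiring
  open SetoidReasoning setoid

  *-cancelʳ-Pos : ∀ {k x y} → Pos k → x * k ≈ y * k → x ≈ y
  *-cancelʳ-Pos {k} {x} {y} pk eq = begin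
    x                ≈⟨ sym (*-identityʳ x) ⟩
    x * 1#           ≈⟨ *-congˡ (sym (inverseʳ pk)) ⟩
    x * (k * inv k)  ≈⟨ sym (*-assoc x k (inv k)) ⟩
    x * k * inv k    ≈⟨ *-congʳ eq ⟩
    y * k * inv k    ≈⟨ *-assoc y k (inv k) ⟩
    y * (k * inv k)  ≈⟨ *-congˡ (inverseʳ pk) ⟩
    y * 1#           ≈⟨ *-identityʳ y ⟩
    y                ∎

  sqrt-* : ∀ {x y} → Pos x → Pos y → sqrt x * sqrt y ≈ sqrt (x * y)
  sqrt-* {x} {y} px py = sqrt-unique (Pos-* px py) (Pos-* (sqrt-Pos px) (sqrt-Pos py)) (begin
    (sqrt x * sqrt y) * (sqrt x * sqrt y)
      ≈⟨ solve 2 (λ s t → (s :* t) :* (s :* t) := (s :* s) :* (t :* t)) refl (sqrt x) (sqrt y) ⟩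
    (sqrt x * sqrt x) * (sqrt y * sqrt y)  ≈⟨ *-cong (sqrt-sq px) (sqrt-sq py) ⟩
    x * y                                  ∎)

  sqrt-square : ∀ {x} → Pos x → x ≈ sqrt (x * x)
  sqrt-square px = sqrt-unique (Pos-* px px) px refl

  hlen-Pos : ∀ {y u v} → Pos y → Pos u → Pos v → Pos (hlen A y u v)
  hlen-Pos py pu pv = Pos-* py (inv-Pos (Pos-* pu pv))

  hlen-*-denominator : ∀ {u v} y → Pos u → Pos v → hlen A y u v * (u * v) ≈ y
  hlen-*-denominator {u} {v} y pu pv = begin
    y * inv (u * v) * (u * v)    ≈⟨ *-assoc y _ _ ⟩
    y * (inv (u * v) * (u * v))  ≈⟨ *-congˡ (trans (*-comm _ _) (inverseʳ (Pos-* pu pv))) ⟩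
    y * 1#                       ≈⟨ *-identityʳ y ⟩
    y                            ∎

  ⊙-·-⊙ : ∀ x y σ θ → (x ⊙ σ) · (y ⊙ θ) ≈ x * y * (σ · θ)
  ⊙-·-⊙ x y σ θ = begin
    (x ⊙ σ) · (y ⊙ θ)  ≈⟨ ·-scaleˡ x σ (y ⊙ θ) ⟩
    x * (σ · (y ⊙ θ))  ≈⟨ *-congˡ (·-scaleʳ y σ θ) ⟩
    x * (y * (σ · θ))  ≈⟨ sym (*-assoc x y _) ⟩
    x * y * (σ · θ)    ∎

  -- At a vertex x with neighbours y, k, z in order: D₁ = λ_{xy}, e = λ_{xk}, D₂ = λ_{xz},
  -- N₁ = λ_{yk}, N₂ = λ_{kz}, f = λ_{yz}.
  hlen-flip : ∀ {N₁ N₂ D₁ D₂ e f} (P : Carrier) →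
    Pos N₁ → Pos N₂ → Pos D₁ → Pos D₂ → Pos e →
    e * f ≈ D₂ * N₁ + N₂ * D₁ + sqrt (D₂ * N₂ * N₁ * D₁) * P →
    hlen A f D₁ D₂ ≈ hlen A N₁ D₁ e + hlen A N₂ e D₂
                     + sqrt (hlen A N₁ D₁ e) * sqrt (hlen A N₂ e D₂) * P
  hlen-flip {N₁} {N₂} {D₁} {D₂} {e} {f} P pN₁ pN₂ pD₁ pD₂ pe flip =
    *-cancelʳ-Pos pM (trans lhs-cleared (sym rhs-cleared))
    where
    h₁ = hlen A N₁ D₁ e
    h₂ = hlen A N₂ e D₂
    M  = D₁ * e * D₂
    pM : Pos M
    pM = Pos-* (Pos-* pD₁ pe) pD₂
    ph₁ : Pos h₁
    ph₁ = hlen-Pos pN₁ pD₁ pe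
    ph₂ : Pos h₂
    ph₂ = hlen-Pos pN₂ pe pD₂

    h₁-cleared : h₁ * M ≈ D₂ * N₁
    h₁-cleared = begin
      h₁ * (D₁ * e * D₂)  ≈⟨ sym (*-assoc h₁ _ D₂) ⟩
      h₁ * (D₁ * e) * D₂  ≈⟨ *-congʳ (hlen-*-denominator N₁ pD₁ pe) ⟩
      N₁ * D₂             ≈⟨ *-comm N₁ D₂ ⟩
      D₂ * N₁             ∎

    h₂-cleared : h₂ * M ≈ N₂ * D₁
    h₂-cleared = begin
      h₂ * (D₁ * e * D₂)  ≈⟨ solve 4 (λ h d₁ ee d₂ → h :* (d₁ :* ee :* d₂) := h :* (ee :* d₂) :* d₁) refl h₂ D₁ e D₂ ⟩
      h₂ * (e * D₂) * D₁  ≈⟨ *-congʳ (hlen-*-denominator N₂ pe pD₂) ⟩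
      N₂ * D₁             ∎

    roots-cleared : sqrt h₁ * sqrt h₂ * M ≈ sqrt (D₂ * N₂ * N₁ * D₁)
    roots-cleared = begin
      sqrt h₁ * sqrt h₂ * M                ≈⟨ *-cong (sqrt-* ph₁ ph₂) (sqrt-square pM) ⟩
      sqrt (h₁ * h₂) * sqrt (M * M)        ≈⟨ sqrt-* (Pos-* ph₁ ph₂) (Pos-* pM pM) ⟩
      sqrt (h₁ * h₂ * (M * M))             ≈⟨ sqrt-cong (begin
        h₁ * h₂ * (M * M)                    ≈⟨ solve 3 (λ x y m → x :* y :* (m :* m) := (x :* m) :* (y :* m)) refl h₁ h₂ M ⟩
        (h₁ * M) * (h₂ * M)                  ≈⟨ *-cong h₁-cleared h₂-cleared ⟩
        (D₂ * N₁) * (N₂ * D₁)                ≈⟨ solve 4 (λ d₂ n₁ n₂ d₁ → (d₂ :* n₁) :* (n₂ :* d₁) := d₂ :* n₂ :* n₁ :* d₁) refl D₂ N₁ N₂ D₁ ⟩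
        D₂ * N₂ * N₁ * D₁                    ∎) ⟩
      sqrt (D₂ * N₂ * N₁ * D₁)             ∎

    lhs-cleared : hlen A f D₁ D₂ * M ≈ e * f
    lhs-cleared = begin
      hlen A f D₁ D₂ * (D₁ * e * D₂)
        ≈⟨ solve 4 (λ h d₁ ee d₂ → h :* (d₁ :* ee :* d₂) := ee :* (h :* (d₁ :* d₂))) refl (hlen A f D₁ D₂) D₁ e D₂ ⟩
      e * (hlen A f D₁ D₂ * (D₁ * D₂))  ≈⟨ *-congˡ (hlen-*-denominator f pD₁ pD₂) ⟩
      e * f                             ∎

    rhs-cleared : (h₁ + h₂ + sqrt h₁ * sqrt h₂ * P) * M ≈ e * f
    rhs-cleared = begin
      (h₁ + h₂ + sqrt h₁ * sqrt h₂ * P) * M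
        ≈⟨ solve 6 (λ x y s t p m → (x :+ y :+ s :* t :* p) :* m := x :* m :+ y :* m :+ (s :* t :* m) :* p)
                   refl h₁ h₂ (sqrt h₁) (sqrt h₂) P M ⟩
      h₁ * M + h₂ * M + (sqrt h₁ * sqrt h₂ * M) * P
        ≈⟨ +-cong (+-cong h₁-cleared h₂-cleared) (*-congʳ roots-cleared) ⟩
      D₂ * N₁ + N₂ * D₁ + sqrt (D₂ * N₂ * N₁ * D₁) * P
        ≈⟨ sym flip ⟩
      e * f ∎

proposition1p5 : ∀ {c ℓ o} (A : SuperAlgebra c ℓ o) →
    let open SuperAlgebra A in
    (a b c' d e f : Carrier) (σ θ : Odd) →
    Pos a → Pos b → Pos c' → Pos d → Pos e → Pos f →
    e * f ≈ a * c' + b * d + sqrt (a * b * c' * d) * (σ · θ) →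
    (hlen A f d a ≈ hlen A c' d e + hlen A b e a + θbar A c' d e σ · θbar A b e a θ)
    × (hlen A f c' b ≈ hlen A d c' e + hlen A a e b + θbar A d c' e σ · θbar A a e b θ)
proposition1p5 A a b c' d e f σ θ pa pb pc pd pe _ flip =
    trans (hlen-flip (σ · θ) pc pb pd pa pe flip) (+-congˡ (sym (⊙-·-⊙ _ _ σ θ)))
  , trans (hlen-flip (σ · θ) pd pa pc pb pe flip-at-k) (+-congˡ (sym (⊙-·-⊙ _ _ σ θ)))
  where
  open SuperAlgebra A
  open SuperAlgebraProperties A
  open RingSolver commutativeSemiring using (solve; _:*_; _:=_)

  flip-at-k : e * f ≈ b * d + a * c' + sqrt (b * a * d * c') * (σ · θ)
  flip-at-k = trans flip (+-cong (+-comm _ _) (*-congʳ (sqrt-cong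
    (solve 4 (λ a b c d → a :* b :* c :* d := b :* a :* d :* c) refl a b c' d))))
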